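{- Let $k\geq 1$ and $n\geq 8$ be integers. Then the following two statements are equivalent: (a) every $k$-strong digraph $H$ of order $n$ for which there exists a vertex $z_0$ such that $d(x)+d(y)\geq 2n-1$ for every pair of non-adjacent distinct vertices $x,y\in V(H)\setminus\{z_0\}$ is Hamiltonian; (b) every $(k+1)$-strong digraph $D$ of order $n+1$ such that $d(x)+d(y)\geq 2(n+1)+1$ for every pair of non-adjacent distinct vertices $x,y$ of $D$ is strongly Hamiltonian-connected.
   Context: All digraphs are finite, without loops and without multiple arcs (opposite arcs $xy$ and $yx$ may both be present). For a vertex $x$, $d(x)=d^+(x)+d^-(x)$. Two distinct vertices $x,y$ are adjacent if $xy$ or $yx$ is an arc. A digraph $D$ is $k$-strong if $|V(D)|\geq k+1$ and $D-A$ is strongly connected for every set $A$ of at most $k-1$ vertices. A digraph is Hamiltonian if it contains a directed cycle through all its vertices. A digraph is strongly Hamiltonian-connected if for every ordered pair of distinct vertices $x,y$ there is a directed path from $x$ to $y$ containing all vertices. -}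

module Defs where

open import Data.Nat using (ℕ; zero; suc; _+_; _*_; _<_; _≤_)
open import Data.Bool using (Bool; true; false; if_then_else_)
open import Data.Fin using (Fin)
open import Data.Fin.Subset using (Subset; _∉_; ∣_∣)
open import Data.List using (List; []; _∷_; _++_; map; allFin)
open import Data.Nat.ListAction using (sum)
open import Data.List.Relation.Unary.Unique.Propositional using (Unique)
open import Data.List.Membership.Propositional using (_∈_)
open import Data.Product using (Σ; _×_; ∃)
open import Relation.Binary.PropositionalEquality using (_≡_)
open import Relation.Nullary using (¬_)

-- A digraph of order n: vertex set Fin n, arc relation given as a Boolean
-- adjacency matrix, with no loops.  (No multiple arcs automatically;
-- opposite arcs xy and yx may both be present.)
record Digraph (n : ℕ) : Set where
  field
    arc      : Fin n → Fin n → Bool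
    loopless : ∀ x → arc x x ≡ false
open Digraph public

outdeg : ∀ {n} → Digraph n → Fin n → ℕ
outdeg {n} D x = sum (map (λ y → if arc D x y then 1 else 0) (allFin n))

indeg : ∀ {n} → Digraph n → Fin n → ℕ
indeg {n} D x = sum (map (λ y → if arc D y x then 1 else 0) (allFin n))

deg : ∀ {n} → Digraph n → Fin n → ℕ
deg D x = outdeg D x + indeg D x

NonAdjacent : ∀ {n} → Digraph n → Fin n → Fin n → Set
NonAdjacent D x y = (arc D x y ≡ false) × (arc D y x ≡ false)

data WalkAvoiding {n} (D : Digraph n) (S : Subset n) : Fin n → Fin n → Set where
  here : ∀ {u} → u ∉ S → WalkAvoiding D S u u
  step : ∀ {u w v} → u ∉ S → arc D u w ≡ true → WalkAvoiding D S w v →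
         WalkAvoiding D S u v

StronglyConnectedMinus : ∀ {n} → Digraph n → Subset n → Set
StronglyConnectedMinus {n} D S =
  ∀ (u v : Fin n) → u ∉ S → v ∉ S → WalkAvoiding D S u v

KStrong : ∀ {n} → ℕ → Digraph n → Set
KStrong {n} k D = (k + 1 ≤ n) × (∀ (S : Subset n) → ∣ S ∣ < k → StronglyConnectedMinus D S)

data ArcChain {n} (D : Digraph n) : List (Fin n) → Set where
  nil  : ArcChain D []
  one  : ∀ x → ArcChain D (x ∷ [])
  cons : ∀ {x y xs} → arc D x y ≡ true → ArcChain D (y ∷ xs) → ArcChain D (x ∷ y ∷ xs)

Spanning : ∀ {n} → List (Fin n) → Set
Spanning {n} xs = Unique xs × (∀ (v : Fin n) → v ∈ xs)

Hamiltonian : ∀ {n} → Digraph n → Set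
Hamiltonian {n} D =
  Σ (Fin n) λ x → Σ (List (Fin n)) λ xs →
    Spanning (x ∷ xs) × ArcChain D ((x ∷ xs) ++ (x ∷ []))

HamPath : ∀ {n} → Digraph n → Fin n → Fin n → Set
HamPath {n} D x y =
  Σ (List (Fin n)) λ mid →
    Spanning (x ∷ (mid ++ (y ∷ []))) × ArcChain D (x ∷ (mid ++ (y ∷ [])))

StronglyHamiltonianConnected : ∀ {n} → Digraph n → Set
StronglyHamiltonianConnected {n} D = ∀ (x y : Fin n) → ¬ (x ≡ y) → HamPath D x y

-- Both directions are reductions (only n ≥ 2 is
-- used):
--   (a) ⇒ (b)  To find a Hamiltonian x-y path in D, merge x and y into one
--              vertex z with the out-arcs of x and the in-arcs of y (module
--              Merge).  The merged digraph is k-strong, degrees off z drop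
--              by at most two, and a Hamiltonian cycle through z unfolds to
--              a Hamiltonian x-y path.
--   (b) ⇒ (a)  Conversely split z₀ into an "exit" x and an "entry" y, joined
--              to everything so that connectivity and degrees grow (module
--              Split); a Hamiltonian x-y path folds back into a cycle.
module Submission where

open import Defs
open import Data.Nat using (ℕ; zero; suc; _+_; _*_; _≤_; _<_; _∸_; z≤n; s≤s)
open import Data.Nat.Properties
  using (+-0-commutativeMonoid; +-comm; +-suc; ≤-trans; ≤-reflexive; +-monoˡ-≤; +-monoʳ-≤; +-mono-≤;
         m≤n+o⇒m∸n≤o; m≤n+m∸n; +-cancelˡ-≤; ≤-pred; module ≤-Reasoning)
open import Data.Nat.Tactic.RingSolver using (solve-∀)
open import Data.Nat.ListAction using (sum)
open import Data.Bool using (Bool; true; false; if_then_else_)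
open import Data.Fin using (Fin; zero; suc; punchIn; punchOut; _≟_)
open import Data.Fin.Properties using (punchInᵢ≢i; punchIn-injective; punchIn-punchOut)
open import Data.Fin.Subset using (Subset; _∉_; ∣_∣; inside; outside)
open import Data.Fin.Subset.Properties using (drop-there; drop-not-there)
open import Data.Vec using (_∷_; lookup; insertAt; _[_]≔_)
open import Data.Vec.Properties
  using (lookup⇒[]=; []=⇒lookup; insertAt-punchIn; insertAt-lookup; lookup∘update; lookup∘update′)
open import Data.List using (List; []; _∷_; _++_; map; allFin; tabulate)
open import Data.List.Properties using (map-tabulate; ++-assoc; map-++)
open import Data.List.Membership.Propositional using () renaming (_∈_ to _∈ₗ_)
open import Data.List.Membership.Propositional.Properties using (∈-∃++; ∈-map⁺; ∈-map⁻)
open import Data.List.Relation.Unary.All using (All; []; _∷_)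
import Data.List.Relation.Unary.All as All
import Data.List.Relation.Unary.All.Properties as All
open import Data.List.Relation.Unary.Any using (here; there)
open import Data.List.Relation.Unary.AllPairs using (_∷_)
open import Data.List.Relation.Unary.Unique.Propositional using (Unique)
import Data.List.Relation.Unary.Unique.Propositional.Properties as U
open import Data.List.Relation.Binary.Permutation.Propositional using (_↭_; ↭⇒↭ₛ; prep; ↭-trans)
open import Data.List.Relation.Binary.Permutation.Propositional.Properties using (∈-resp-↭; shift; ++-comm)
open import Data.List.Relation.Binary.Permutation.Setoid.Properties using (Unique-resp-↭)
open import Data.Product using (Σ; _×_; _,_; proj₁; proj₂)
open import Data.Sum using (_⊎_; inj₁; inj₂; reduce)
open import Data.Unit using (⊤; tt)
open import Function using (_∘_)
open import Function.Bundles using (_⇔_; mk⇔)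
open import Relation.Binary.PropositionalEquality
open import Relation.Nullary using (¬_; yes; no; contradiction; Dec)
open import Algebra.Properties.CommutativeMonoid.Sum +-0-commutativeMonoid
  using (sum-remove; sum-cong-≗) renaming (sum to ∑)

⟦_⟧ : Bool → ℕ
⟦ b ⟧ = if b then 1 else 0

⟦⟧≤1 : ∀ b → ⟦ b ⟧ ≤ 1
⟦⟧≤1 true  = s≤s z≤n
⟦⟧≤1 false = z≤n

-- Degrees are sums over the list 'allFin n'; we compute with the
-- functional sum '∑', for which removing one summand is a library lemma.
sum-allFin : ∀ {n} (f : Fin n → ℕ) → sum (map f (allFin n)) ≡ ∑ f
sum-allFin {n} f = trans (cong sum (map-tabulate (λ i → i) f)) (go f)
  where
  go : ∀ {m} (g : Fin m → ℕ) → sum (tabulate g) ≡ ∑ g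
  go {zero}  g = refl
  go {suc m} g = cong (g zero +_) (go (g ∘ suc))

outdeg≡∑ : ∀ {n} (D : Digraph n) w → outdeg D w ≡ ∑ (λ v → ⟦ arc D w v ⟧)
outdeg≡∑ D w = sum-allFin (λ v → ⟦ arc D w v ⟧)

indeg≡∑ : ∀ {n} (D : Digraph n) w → indeg D w ≡ ∑ (λ v → ⟦ arc D v w ⟧)
indeg≡∑ D w = sum-allFin (λ v → ⟦ arc D v w ⟧)

∑-remove-indicator : ∀ {n} (p : Fin (suc n) → Bool) i →
  ∑ (⟦_⟧ ∘ p) ≤ 1 + ∑ (⟦_⟧ ∘ p ∘ punchIn i)
∑-remove-indicator p i =
  ≤-trans (≤-reflexive (sum-remove {i = i} (⟦_⟧ ∘ p))) (+-monoˡ-≤ _ (⟦⟧≤1 (p i)))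

∑-agree-except : ∀ {n} {f g : Fin (suc n) → ℕ} i → (∀ j → j ≢ i → f j ≡ g j) →
  ∑ f + g i ≡ ∑ g + f i
∑-agree-except {f = f} {g} i agree = begin
  ∑ f + g i                      ≡⟨ cong (_+ g i) (sum-remove {i = i} f) ⟩
  f i + ∑ (f ∘ punchIn i) + g i  ≡⟨ cong (λ r → f i + r + g i) (sum-cong-≗ rest) ⟩
  f i + ∑ (g ∘ punchIn i) + g i  ≡⟨ swap-ends (f i) _ (g i) ⟩
  g i + ∑ (g ∘ punchIn i) + f i  ≡⟨ cong (_+ f i) (sum-remove {i = i} g) ⟨
  ∑ g + f i                      ∎
  where
  open ≡-Reasoning
  rest : ∀ j → f (punchIn i j) ≡ g (punchIn i j)
  rest j = agree (punchIn i j) (punchInᵢ≢i i j)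
  swap-ends : ∀ a r b → a + r + b ≡ b + r + a
  swap-ends = solve-∀

∣add∣ : ∀ {n} (T : Subset n) i → lookup T i ≡ outside → ∣ T [ i ]≔ inside ∣ ≡ suc ∣ T ∣
∣add∣ (outside ∷ T) zero    refl = refl
∣add∣ (outside ∷ T) (suc i) eq   = ∣add∣ T i eq
∣add∣ (inside  ∷ T) (suc i) eq   = cong suc (∣add∣ T i eq)

∣remove∣ : ∀ {n} (T : Subset n) i → lookup T i ≡ inside → suc ∣ T [ i ]≔ outside ∣ ≡ ∣ T ∣
∣remove∣ (inside  ∷ T) zero    refl = refl
∣remove∣ (outside ∷ T) (suc i) eq   = ∣remove∣ T i eq
∣remove∣ (inside  ∷ T) (suc i) eq   = cong suc (∣remove∣ T i eq)

∣insertAt∣ : ∀ {n} (T : Subset n) i b → ∣ insertAt T i b ∣ ≡ ⟦ b ⟧ + ∣ T ∣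
∣insertAt∣ T       zero    inside  = refl
∣insertAt∣ T       zero    outside = refl
∣insertAt∣ (outside ∷ T) (suc i) b = ∣insertAt∣ T i b
∣insertAt∣ (inside  ∷ T) (suc i) b = trans (cong suc (∣insertAt∣ T i b)) (sym (+-suc ⟦ b ⟧ ∣ T ∣))

outside⇒∉ : ∀ {n} {S : Subset n} {u} → lookup S u ≡ outside → u ∉ S
outside⇒∉ eq u∈S with trans (sym ([]=⇒lookup u∈S)) eq
... | ()

∉⇒outside : ∀ {n} {S : Subset n} {u} → u ∉ S → lookup S u ≡ outside
∉⇒outside {S = S} {u} u∉S with lookup S u in eq
... | inside  = contradiction (lookup⇒[]= u S eq) u∉S
... | outside = refl

inside⇒¬∉ : ∀ {n} {S : Subset n} {u} → lookup S u ≡ inside → ¬ u ∉ S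
inside⇒¬∉ {S = S} {u} eq u∉S = u∉S (lookup⇒[]= u S eq)

-- A walk in D - S whose every arc a → b satisfies the side condition R a b.
-- Side conditions let a walk be transported along a vertex map that only
-- preserves some of the arcs.
data RWalk {n} (D : Digraph n) (S : Subset n) (R : Fin n → Fin n → Set) :
           Fin n → Fin n → Set where
  stay : ∀ {u} → u ∉ S → RWalk D S R u u
  move : ∀ {u w v} → u ∉ S → R u w → arc D u w ≡ true → RWalk D S R w v → RWalk D S R u v

module _ {n} {D : Digraph n} {S : Subset n} where

  unrestricted : ∀ {u v} → WalkAvoiding D S u v → RWalk D S (λ _ _ → ⊤) u v
  unrestricted (here u∉S)       = stay u∉S
  unrestricted (step u∉S a∈D W) = move u∉S tt a∈D (unrestricted W)

  _⊕_ : ∀ {u w v} → WalkAvoiding D S u w → WalkAvoiding D S w v → WalkAvoiding D S u v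
  here _       ⊕ W' = W'
  step u∉S a W ⊕ W' = step u∉S a (W ⊕ W')

  upToFirst : ∀ {u} y → WalkAvoiding D S u y → RWalk D S (λ a _ → a ≢ y) u y
  upToFirst y (here u∉S) = stay u∉S
  upToFirst {u} y (step u∉S a W) with u ≟ y
  ... | yes refl = stay u∉S
  ... | no  u≢y  = move u∉S u≢y a (upToFirst y W)

  lastVisit : ∀ x {u v} → WalkAvoiding D S u v →
    RWalk D S (λ _ b → b ≢ x) u v ⊎ RWalk D S (λ _ b → b ≢ x) x v
  lastVisit x (here u∉S) = inj₁ (stay u∉S)
  lastVisit x (step {w = w} u∉S a W) with lastVisit x W | w ≟ x
  ... | inj₂ R | _        = inj₂ R
  ... | inj₁ R | yes refl = inj₂ R
  ... | inj₁ R | no  w≢x  = inj₁ (move u∉S w≢x a R)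

  fromLast : ∀ {x v} → WalkAvoiding D S x v → RWalk D S (λ _ b → b ≢ x) x v
  fromLast {x} W = reduce (lastVisit x W)

transport : ∀ {n m} {D : Digraph n} {G : Digraph m} {S S' R u v} (f : Fin n → Fin m) →
  (∀ {w} → w ∉ S → f w ∉ S') →
  (∀ {a b} → a ∉ S → b ∉ S → R a b → arc D a b ≡ true → arc G (f a) (f b) ≡ true) →
  RWalk D S R u v → WalkAvoiding G S' (f u) (f v)
transport f outside-to-outside arc-to-arc = go
  where
  go : ∀ {u v} → RWalk _ _ _ u v → WalkAvoiding _ _ (f u) (f v)
  go (stay u∉S) = here (outside-to-outside u∉S)
  go (move u∉S r a W) = step (outside-to-outside u∉S) (arc-to-arc u∉S (start∉ W) r a) (go W)
    where
    start∉ : ∀ {w v} → RWalk _ _ _ w v → w ∉ _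
    start∉ (stay w∉S)       = w∉S
    start∉ (move w∉S _ _ _) = w∉S

module _ {n} {D : Digraph n} where

  chain-split : ∀ A b B → ArcChain D (A ++ b ∷ B) → ArcChain D (A ++ b ∷ []) × ArcChain D (b ∷ B)
  chain-split []           b B c          = one b , c
  chain-split (a ∷ [])     b B (cons e c) = cons e (one b) , c
  chain-split (a ∷ a' ∷ A) b B (cons e c) with chain-split (a' ∷ A) b B c
  ... | c₁ , c₂ = cons e c₁ , c₂

  chain-join : ∀ A b B → ArcChain D (A ++ b ∷ []) → ArcChain D (b ∷ B) → ArcChain D (A ++ b ∷ B)
  chain-join []           b B _           c₂ = c₂
  chain-join (a ∷ [])     b B (cons e _)  c₂ = cons e c₂
  chain-join (a ∷ a' ∷ A) b B (cons e c₁) c₂ = cons e (chain-join (a' ∷ A) b B c₁ c₂)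

spanning-↭ : ∀ {n} {xs ys : List (Fin n)} → xs ↭ ys → Spanning xs → Spanning ys
spanning-↭ {n} p (unique , covers) =
  Unique-resp-↭ (setoid (Fin n)) (↭⇒↭ₛ p) unique , λ v → ∈-resp-↭ p (covers v)

HamCycleFrom : ∀ {n} → Digraph n → Fin n → List (Fin n) → Set
HamCycleFrom D z R = Spanning (z ∷ R) × ArcChain D (z ∷ R ++ z ∷ [])

rotate : ∀ {n} {D : Digraph n} → Hamiltonian D → ∀ z → Σ (List (Fin n)) (HamCycleFrom D z)
rotate {n} {D} (c , cs , spanning , cycle) z with ∈-∃++ (proj₂ spanning z)
... | []     , Q , refl = Q , spanning , cycle
... | p ∷ P , Q , refl = Q ++ p ∷ P , spanning-↭ reorder spanning , rotated
  where
  reorder : p ∷ P ++ z ∷ Q ↭ z ∷ Q ++ p ∷ P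
  reorder = ↭-trans (shift z (p ∷ P) Q) (prep z (++-comm (p ∷ P) Q))
  halves : ArcChain D (p ∷ P ++ z ∷ []) × ArcChain D (z ∷ Q ++ p ∷ [])
  halves = chain-split (p ∷ P) z (Q ++ p ∷ [])
             (subst (ArcChain D) (cong (p ∷_) (++-assoc P (z ∷ Q) (p ∷ []))) cycle)
  rotated : ArcChain D (z ∷ (Q ++ p ∷ P) ++ z ∷ [])
  rotated = subst (ArcChain D) (cong (z ∷_) (sym (++-assoc Q (p ∷ P) (z ∷ []))))
              (chain-join (z ∷ Q) p (P ++ z ∷ []) (proj₂ halves) (proj₁ halves))

spanning-punchIn : ∀ {n} i {L : List (Fin n)} → Spanning L → Spanning (i ∷ map (punchIn i) L)
spanning-punchIn i {L} (unique , covers) = fresh ∷ U.map⁺ (punchIn-injective i _ _) unique , covers′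
  where
  fresh : All (i ≢_) (map (punchIn i) L)
  fresh = All.map⁺ (All.universal (λ a → punchInᵢ≢i i a ∘ sym) L)
  covers′ : ∀ v → v ∈ₗ i ∷ map (punchIn i) L
  covers′ v with i ≟ v
  ... | yes refl = here refl
  ... | no  i≢v  = there (subst (_∈ₗ map (punchIn i) L) (punchIn-punchOut i≢v)
                                (∈-map⁺ (punchIn i) (covers (punchOut i≢v))))

spanning-suc⁻ : ∀ {n} {L : List (Fin n)} → Spanning (zero ∷ map suc L) → Spanning L
spanning-suc⁻ {L = L} (_ ∷ unique , covers) = U.map⁻ unique , covers′
  where
  covers′ : ∀ v → v ∈ₗ L
  covers′ v with covers (suc v)
  ... | there m with ∈-map⁻ suc m
  ...   | a , a∈L , refl = a∈L

last-fresh : ∀ {A : Set} (L : List A) a → Unique (L ++ a ∷ []) → All (_≢ a) L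
last-fresh []      a _                       = []
last-fresh (b ∷ L) a (b≢later ∷ unique-rest) with All.++⁻ʳ L b≢later
... | b≢a ∷ [] = b≢a ∷ last-fresh L a unique-rest

all-suc : ∀ {n} (L : List (Fin (suc n))) → All (_≢ zero) L → Σ (List (Fin n)) (λ L₀ → L ≡ map suc L₀)
all-suc []          []                = [] , refl
all-suc (zero  ∷ L) (zero≢zero ∷ _)   = contradiction refl zero≢zero
all-suc (suc a ∷ L) (_ ∷ avoid-zero) with all-suc L avoid-zero
... | L₀ , refl = a ∷ L₀ , refl

-- Both constructions change degrees by exactly (or at most) two, which turns
-- the degree threshold 2(n+1)+1 on n+1 vertices into 2n-1 on n vertices.
private
  lhs : ∀ n → 2 * suc n + 1 ≡ 3 + 2 * n
  lhs = solve-∀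
  rhs : ∀ s → s + 4 ≡ 3 + (1 + s)
  rhs = solve-∀

threshold-down : ∀ n s → 2 * suc n + 1 ≤ s + 4 → 2 * n ∸ 1 ≤ s
threshold-down n s le = m≤n+o⇒m∸n≤o (2 * n) 1
  (+-cancelˡ-≤ 3 (2 * n) (1 + s) (subst₂ _≤_ (lhs n) (rhs s) le))

threshold-up : ∀ n s → 2 * n ∸ 1 ≤ s → 2 * suc n + 1 ≤ s + 4
threshold-up n s le = subst₂ _≤_ (sym (lhs n)) (sym (rhs s))
  (+-monoʳ-≤ 3 (≤-trans (m≤n+m∸n (2 * n) 1) (+-monoʳ-≤ 1 le)))

DegreeConditionAway : ∀ {n} → Digraph n → Fin n → Set
DegreeConditionAway {n} H z₀ = ∀ (x y : Fin n) → x ≢ z₀ → y ≢ z₀ → x ≢ y →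
  NonAdjacent H x y → 2 * n ∸ 1 ≤ deg H x + deg H y

DegreeCondition : ∀ {N} → Digraph N → Set
DegreeCondition {N} D = ∀ (x y : Fin N) → x ≢ y →
  NonAdjacent D x y → 2 * N + 1 ≤ deg D x + deg D y

-- The vertices of H are Fin (suc n), the vertex a
-- standing for ι a = punchIn x a of D, so that z = punchOut x≢y stands for y.
module Merge {n} (D : Digraph (suc (suc n))) {x y : Fin (suc (suc n))} (x≢y : x ≢ y) where

  ι : Fin (suc n) → Fin (suc (suc n))
  ι = punchIn x

  z : Fin (suc n)
  z = punchOut x≢y

  ι-z : ι z ≡ y
  ι-z = punchIn-punchOut x≢y

  mergedArc : Fin (suc n) → Fin (suc n) → Bool
  mergedArc a b with a ≟ z | b ≟ z
  ... | yes _ | yes _ = false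
  ... | yes _ | no  _ = arc D x (ι b)
  ... | no  _ | _     = arc D (ι a) (ι b)

  H : Digraph (suc n)
  H = record { arc = mergedArc ; loopless = no-loop }
    where
    no-loop : ∀ a → mergedArc a a ≡ false
    no-loop a with a ≟ z
    ... | yes _ = refl
    ... | no  _ = loopless D (ι a)

  arc-H : ∀ {a} b → a ≢ z → arc H a b ≡ arc D (ι a) (ι b)
  arc-H {a} b a≢z with a ≟ z
  ... | yes a≡z = contradiction a≡z a≢z
  ... | no  _   = refl

  arc-H-z : ∀ {b} → b ≢ z → arc H z b ≡ arc D x (ι b)
  arc-H-z {b} b≢z with z ≟ z | b ≟ z
  ... | no  z≢z | _       = contradiction refl z≢z
  ... | yes _   | yes b≡z = contradiction b≡z b≢z
  ... | yes _   | no  _   = refl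

  squash : Fin (suc (suc n)) → Fin (suc n)
  squash w with x ≟ w
  ... | yes _   = z
  ... | no  x≢w = punchOut x≢w

  ι-squash : ∀ {w} → w ≢ x → ι (squash w) ≡ w
  ι-squash {w} w≢x with x ≟ w
  ... | yes x≡w = contradiction (sym x≡w) w≢x
  ... | no  x≢w = punchIn-punchOut x≢w

  squash-ι : ∀ a → squash (ι a) ≡ a
  squash-ι a = punchIn-injective x _ _ (ι-squash (punchInᵢ≢i x a))

  squash-x : squash x ≡ z
  squash-x with x ≟ x
  ... | yes _   = refl
  ... | no  x≢x = contradiction refl x≢x

  squash-y : squash y ≡ z
  squash-y = trans (cong squash (sym ι-z)) (squash-ι z)

  squash-≢z : ∀ {w} → w ≢ x → w ≢ y → squash w ≢ z
  squash-≢z w≢x w≢y squash≡z = w≢y (trans (sym (ι-squash w≢x)) (trans (cong ι squash≡z) ι-z))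

  squash-arc : ∀ {w w'} → w ≢ x → w ≢ y → w' ≢ x → arc D w w' ≡ true →
    arc H (squash w) (squash w') ≡ true
  squash-arc w≢x w≢y w'≢x e =
    trans (arc-H _ (squash-≢z w≢x w≢y)) (trans (cong₂ (arc D) (ι-squash w≢x) (ι-squash w'≢x)) e)

  squash-arc-x : ∀ {w'} → w' ≢ x → w' ≢ y → arc D x w' ≡ true → arc H z (squash w') ≡ true
  squash-arc-x w'≢x w'≢y e = trans (arc-H-z (squash-≢z w'≢x w'≢y)) (trans (cong (arc D x) (ι-squash w'≢x)) e)

  -- Away from z, merging loses at most one out-arc (towards x) and one
  -- in-arc (from y) at every vertex.
  outdeg-ι : ∀ u → u ≢ z → outdeg D (ι u) ≤ 1 + outdeg H u
  outdeg-ι u u≢z = begin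
    outdeg D (ι u)                        ≡⟨ outdeg≡∑ D (ι u) ⟩
    ∑ (λ v → ⟦ arc D (ι u) v ⟧)           ≤⟨ ∑-remove-indicator (arc D (ι u)) x ⟩
    1 + ∑ (λ b → ⟦ arc D (ι u) (ι b) ⟧)   ≡⟨ cong (1 +_) (sum-cong-≗ (λ b → cong ⟦_⟧ (arc-H b u≢z))) ⟨
    1 + ∑ (λ b → ⟦ arc H u b ⟧)           ≡⟨ cong (1 +_) (outdeg≡∑ H u) ⟨
    1 + outdeg H u                        ∎
    where open ≤-Reasoning

  indeg-ι : ∀ u → u ≢ z → indeg D (ι u) ≤ 1 + indeg H u
  indeg-ι u u≢z = begin
    indeg D (ι u)                            ≡⟨ indeg≡∑ D (ι u) ⟩
    ∑ (λ v → ⟦ arc D v (ι u) ⟧)              ≡⟨ sum-remove {i = x} (λ v → ⟦ arc D v (ι u) ⟧) ⟩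
    ⟦ arc D x (ι u) ⟧ + ∑ from-copies        ≤⟨ +-monoʳ-≤ _ (∑-remove-indicator (λ b → arc D (ι b) (ι u)) z) ⟩
    ⟦ arc D x (ι u) ⟧ + (1 + ∑ from-others)  ≡⟨ +-suc _ _ ⟩
    1 + (⟦ arc D x (ι u) ⟧ + ∑ from-others)  ≡⟨ cong (1 +_) in-H ⟨
    1 + indeg H u                            ∎
    where
    open ≤-Reasoning
    from-copies : Fin (suc n) → ℕ
    from-copies b = ⟦ arc D (ι b) (ι u) ⟧
    from-others : Fin n → ℕ
    from-others j = from-copies (punchIn z j)
    -- In H, z supplies the arc from x, and every other vertex its own arc.
    in-H : indeg H u ≡ ⟦ arc D x (ι u) ⟧ + ∑ from-others
    in-H = begin-equality
      indeg H u                                                ≡⟨ indeg≡∑ H u ⟩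
      ∑ (λ b → ⟦ arc H b u ⟧)                                  ≡⟨ sum-remove {i = z} (λ b → ⟦ arc H b u ⟧) ⟩
      ⟦ arc H z u ⟧ + ∑ (λ j → ⟦ arc H (punchIn z j) u ⟧)     ≡⟨ cong₂ (λ e r → ⟦ e ⟧ + r) (arc-H-z u≢z)
                                                                    (sum-cong-≗ (λ j → cong ⟦_⟧ (arc-H u (punchInᵢ≢i z j)))) ⟩
      ⟦ arc D x (ι u) ⟧ + ∑ from-others                        ∎

  deg-ι : ∀ u → u ≢ z → deg D (ι u) ≤ deg H u + 2
  deg-ι u u≢z = ≤-trans (+-mono-≤ (outdeg-ι u u≢z) (indeg-ι u u≢z)) (≤-reflexive (regroup _ _))
    where
    regroup : ∀ o i → 1 + o + (1 + i) ≡ o + i + 2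
    regroup = solve-∀

  merged-degree : DegreeCondition D → DegreeConditionAway H z
  merged-degree condition u v u≢z v≢z u≢v (uv∉H , vu∉H) =
    threshold-down (suc n) (deg H u + deg H v) (begin
      2 * suc (suc n) + 1          ≤⟨ condition (ι u) (ι v) (u≢v ∘ punchIn-injective x u v) nonadjacent ⟩
      deg D (ι u) + deg D (ι v)    ≤⟨ +-mono-≤ (deg-ι u u≢z) (deg-ι v v≢z) ⟩
      deg H u + 2 + (deg H v + 2)  ≡⟨ regroup (deg H u) (deg H v) ⟩
      deg H u + deg H v + 4        ∎)
    where
    open ≤-Reasoning
    nonadjacent : NonAdjacent D (ι u) (ι v)
    nonadjacent = trans (sym (arc-H v u≢z)) uv∉H , trans (sym (arc-H u v≢z)) vu∉H
    regroup : ∀ p q → p + 2 + (q + 2) ≡ p + q + 4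
    regroup = solve-∀

  -- A vertex set of H lifted to D, x getting membership b (and y, being ι z,
  -- inheriting the membership of z).
  lift : Subset (suc n) → Bool → Subset (suc (suc n))
  lift T b = insertAt T x b

  lift-ι : ∀ T b a → lookup (lift T b) (ι a) ≡ lookup T a
  lift-ι T b a = insertAt-punchIn T x b a

  lift-squash : ∀ T b {w} → w ≢ x → lookup (lift T b) w ≡ lookup T (squash w)
  lift-squash T b {w} w≢x = trans (cong (lookup (lift T b)) (sym (ι-squash w≢x))) (lift-ι T b (squash w))

  lift-y : ∀ T b → lookup (lift T b) y ≡ lookup T z
  lift-y T b = trans (lift-squash T b (x≢y ∘ sym)) (cong (lookup T) squash-y)

  -- H - T is strongly connected when D minus any k vertices is.  If z ∈ T,
  -- delete x as well; otherwise route through z, entering it along a walk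
  -- to y and leaving it along a walk from x.
  module Connectivity (k : ℕ)
    (strong : ∀ (S : Subset (suc (suc n))) → ∣ S ∣ < k + 1 → StronglyConnectedMinus D S)
    (T : Subset (suc n)) (small : ∣ T ∣ < k) where

    one-more : ∀ (S : Subset (suc (suc n))) → ∣ S ∣ ≡ suc ∣ T ∣ → ∣ S ∣ < k + 1
    one-more S eq = subst₂ _<_ (sym eq) (+-comm 1 k) (s≤s small)

    -- S₁ is T together with x; it contains y exactly when z ∈ T.
    S₁ : Subset (suc (suc n))
    S₁ = lift T inside

    ∉S₁⇒≢x : ∀ {w} → w ∉ S₁ → w ≢ x
    ∉S₁⇒≢x w∉S₁ refl = inside⇒¬∉ (insertAt-lookup T x inside) w∉S₁

    ∉S₁⇒squash∉ : ∀ {w} → w ∉ S₁ → squash w ∉ T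
    ∉S₁⇒squash∉ w∉S₁ = outside⇒∉ (trans (sym (lift-squash T inside (∉S₁⇒≢x w∉S₁))) (∉⇒outside w∉S₁))

    ι∉S₁ : ∀ {a} → a ∉ T → ι a ∉ S₁
    ι∉S₁ {a} a∉T = outside⇒∉ (trans (lift-ι T inside a) (∉⇒outside a∉T))

    walk-S₁ : ∀ {u v} → u ∉ T → v ∉ S₁ → WalkAvoiding D S₁ (ι u) v
    walk-S₁ u∉T v∉S₁ = strong S₁ (one-more S₁ (∣insertAt∣ T x inside)) _ _ (ι∉S₁ u∉T) v∉S₁

    -- If z ∈ T, then D - S₁ avoids both x and y and squashes into H - T.
    z-deleted : lookup T z ≡ inside → ∀ {u v} → u ∉ T → v ∉ T → WalkAvoiding H T u v
    z-deleted z∈T {u} {v} u∉T v∉T = subst₂ (WalkAvoiding H T) (squash-ι u) (squash-ι v)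
      (transport squash ∉S₁⇒squash∉
        (λ a∉S₁ b∉S₁ _ → squash-arc (∉S₁⇒≢x a∉S₁) (∉S₁⇒≢y a∉S₁) (∉S₁⇒≢x b∉S₁))
        (unrestricted (walk-S₁ u∉T (ι∉S₁ v∉T))))
      where
      ∉S₁⇒≢y : ∀ {w} → w ∉ S₁ → w ≢ y
      ∉S₁⇒≢y w∉S₁ refl = inside⇒¬∉ (trans (lift-y T inside) z∈T) w∉S₁

    -- If z ∉ T: follow a walk of D - S₁ to y up to its first visit of y.
    to-z : lookup T z ≡ outside → ∀ {u} → u ∉ T → WalkAvoiding H T u z
    to-z z∉T {u} u∉T = subst₂ (WalkAvoiding H T) (squash-ι u) squash-y
      (transport squash ∉S₁⇒squash∉
        (λ a∉S₁ b∉S₁ a≢y → squash-arc (∉S₁⇒≢x a∉S₁) a≢y (∉S₁⇒≢x b∉S₁))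
        (upToFirst y (walk-S₁ u∉T (outside⇒∉ (trans (lift-y T inside) z∉T)))))

    -- If z ∉ T: leave z along a walk of D - S₂ from x, after its last visit of x.
    from-z : lookup T z ≡ outside → ∀ {v} → v ∉ T → v ≢ z → WalkAvoiding H T z v
    from-z z∉T {v} v∉T v≢z = subst₂ (WalkAvoiding H T) squash-x (squash-ι v)
      (transport squash ∉S₂⇒squash∉ arc-survives
        (fromLast (strong S₂ (one-more S₂ ∣S₂∣) x (ι v) x∉S₂ ιv∉S₂)))
      where
      -- S₂ is T plus z, lifted so that it contains y but not x.
      T′ : Subset (suc n)
      T′ = T [ z ]≔ inside
      S₂ : Subset (suc (suc n))
      S₂ = lift T′ outside

      ∣S₂∣ : ∣ S₂ ∣ ≡ suc ∣ T ∣
      ∣S₂∣ = trans (∣insertAt∣ T′ x outside) (∣add∣ T z z∉T)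

      x∉S₂ : x ∉ S₂
      x∉S₂ = outside⇒∉ (insertAt-lookup T′ x outside)

      ιv∉S₂ : ι v ∉ S₂
      ιv∉S₂ = outside⇒∉ (trans (lift-ι T′ outside v) (trans (lookup∘update′ v≢z T inside) (∉⇒outside v∉T)))

      ∉S₂⇒≢y : ∀ {w} → w ∉ S₂ → w ≢ y
      ∉S₂⇒≢y w∉S₂ refl = inside⇒¬∉ (trans (lift-y T′ outside) (lookup∘update z T inside)) w∉S₂

      ∉S₂⇒squash∉ : ∀ {w} → w ∉ S₂ → squash w ∉ T
      ∉S₂⇒squash∉ {w} w∉S₂ with w ≟ x
      ... | yes refl = outside⇒∉ (trans (cong (lookup T) squash-x) z∉T)
      ... | no  w≢x  = outside⇒∉ (trans (sym (lookup∘update′ (squash-≢z w≢x (∉S₂⇒≢y w∉S₂)) T inside))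
                                        (trans (sym (lift-squash T′ outside w≢x)) (∉⇒outside w∉S₂)))

      arc-survives : ∀ {a b} → a ∉ S₂ → b ∉ S₂ → b ≢ x → arc D a b ≡ true →
        arc H (squash a) (squash b) ≡ true
      arc-survives {a} {b} a∉S₂ b∉S₂ b≢x e with a ≟ x
      ... | yes refl = trans (cong (λ c → arc H c (squash b)) squash-x) (squash-arc-x b≢x (∉S₂⇒≢y b∉S₂) e)
      ... | no  a≢x  = squash-arc a≢x (∉S₂⇒≢y a∉S₂) b≢x e

    connected : StronglyConnectedMinus H T
    connected u v u∉T v∉T with lookup T z in z-status | v ≟ z
    ... | inside  | _        = z-deleted z-status u∉T v∉T
    ... | outside | yes refl = to-z z-status u∉T
    ... | outside | no  v≢z  = to-z z-status u∉T ⊕ from-z z-status v∉T v≢z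

  merged-strong : ∀ k → KStrong (k + 1) D → KStrong k H
  merged-strong k (order , strong) =
    ≤-pred (subst (_≤ suc (suc n)) (+-comm (k + 1) 1) order) , Connectivity.connected k strong

  lift-chain : ∀ L → All (z ≢_) L → ArcChain H (L ++ z ∷ []) → ArcChain D (map ι L ++ y ∷ [])
  lift-chain []          _                 _          = one y
  lift-chain (a ∷ [])    (z≢a ∷ [])        (cons e _) =
    cons (subst (λ c → arc D (ι a) c ≡ true) ι-z (trans (sym (arc-H z (z≢a ∘ sym))) e)) (one y)
  lift-chain (a ∷ b ∷ L) (z≢a ∷ z≢others) (cons e c) =
    cons (trans (sym (arc-H b (z≢a ∘ sym))) e) (lift-chain (b ∷ L) z≢others c)

  hamiltonian-path : Hamiltonian H → HamPath D x y
  hamiltonian-path ham with rotate ham z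
  ... | []    , _ , cons z→z _ = contradiction (trans (sym z→z) (loopless H z)) λ ()
  ... | r ∷ R , spanning@((z≢r ∷ z≢R) ∷ _ , _) , cons z→r chain =
    map ι (r ∷ R) , spanning′ , cons (trans (sym (arc-H-z (z≢r ∘ sym))) z→r) (lift-chain (r ∷ R) (z≢r ∷ z≢R) chain)
    where
    spanning′ : Spanning (x ∷ (map ι (r ∷ R) ++ y ∷ []))
    spanning′ = subst (λ L → Spanning (x ∷ L)) (trans (map-++ ι (r ∷ R) (z ∷ [])) (cong (λ c → map ι (r ∷ R) ++ c ∷ []) ι-z))
                  (spanning-punchIn x (spanning-↭ (++-comm (z ∷ []) (r ∷ R)) spanning))

-- Given H with exceptional vertex z₀, split
-- z₀ into x = suc z₀, keeping the out-arcs of z₀, and a new vertex y = zero,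
-- keeping its in-arcs; further, every vertex sends an arc to x and receives
-- one from y, and x → y.  A Hamiltonian path of D from x to y is then a
-- Hamiltonian cycle of H, while degrees off z₀ grow by two and connectivity
-- by one.
module Split {N} (H : Digraph (suc N)) (z₀ : Fin (suc N)) where

  x : Fin (suc (suc N))
  x = suc z₀

  splitArc : Fin (suc (suc N)) → Fin (suc (suc N)) → Bool
  splitArc zero    zero    = false
  splitArc zero    (suc b) = true
  splitArc (suc a) zero    with a ≟ z₀
  ... | yes _ = true
  ... | no  _ = arc H a z₀
  splitArc (suc a) (suc b) with a ≟ z₀ | b ≟ z₀
  ... | yes _ | yes _ = false
  ... | no  _ | yes _ = true
  ... | _     | no  _ = arc H a b

  D : Digraph (suc (suc N))
  D = record { arc = splitArc ; loopless = no-loop }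
    where
    no-loop : ∀ a → splitArc a a ≡ false
    no-loop zero = refl
    no-loop (suc a) with a ≟ z₀
    ... | yes _ = refl
    ... | no  _ = loopless H a

  arc-D : ∀ {a b} → b ≢ z₀ → arc D (suc a) (suc b) ≡ arc H a b
  arc-D {a} {b} b≢z₀ with a ≟ z₀ | b ≟ z₀
  ... | _     | yes b≡z₀ = contradiction b≡z₀ b≢z₀
  ... | yes _ | no  _    = refl
  ... | no  _ | no  _    = refl

  arc-D-to-x : ∀ {a} → a ≢ z₀ → arc D (suc a) x ≡ true
  arc-D-to-x {a} a≢z₀ with a ≟ z₀ | z₀ ≟ z₀
  ... | yes a≡z₀ | _       = contradiction a≡z₀ a≢z₀
  ... | no  _    | yes _   = refl
  ... | no  _    | no z₀≢z₀ = contradiction refl z₀≢z₀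

  arc-D-to-y : ∀ {a} → a ≢ z₀ → arc D (suc a) zero ≡ arc H a z₀
  arc-D-to-y {a} a≢z₀ with a ≟ z₀
  ... | yes a≡z₀ = contradiction a≡z₀ a≢z₀
  ... | no  _    = refl

  arc-x-y : arc D x zero ≡ true
  arc-x-y with z₀ ≟ z₀
  ... | yes _    = refl
  ... | no z₀≢z₀ = contradiction refl z₀≢z₀

  arc⇒≢ : ∀ {a b} → arc H a b ≡ true → a ≢ b
  arc⇒≢ {a} e refl with trans (sym e) (loopless H a)
  ... | ()

  suc-arc : ∀ {a b} → arc H a b ≡ true → arc D (suc a) (suc b) ≡ true
  suc-arc {a} {b} e = by-cases (b ≟ z₀)
    where
    by-cases : Dec (b ≡ z₀) → arc D (suc a) (suc b) ≡ true
    by-cases (yes refl) = arc-D-to-x (arc⇒≢ e)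
    by-cases (no b≢z₀)  = trans (arc-D b≢z₀) e

  -- Every arc of H also survives when z₀ is represented by y instead.
  φ : Fin (suc N) → Fin (suc (suc N))
  φ a with a ≟ z₀
  ... | yes _ = zero
  ... | no  _ = suc a

  φ-z₀ : φ z₀ ≡ zero
  φ-z₀ with z₀ ≟ z₀
  ... | yes _    = refl
  ... | no z₀≢z₀ = contradiction refl z₀≢z₀

  φ-≢z₀ : ∀ {a} → a ≢ z₀ → φ a ≡ suc a
  φ-≢z₀ {a} a≢z₀ with a ≟ z₀
  ... | yes a≡z₀ = contradiction a≡z₀ a≢z₀
  ... | no  _    = refl

  φ-arc : ∀ {a b} → arc H a b ≡ true → arc D (φ a) (φ b) ≡ true
  φ-arc {a} {b} e = by-cases (a ≟ z₀) (b ≟ z₀)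
    where
    by-cases : Dec (a ≡ z₀) → Dec (b ≡ z₀) → arc D (φ a) (φ b) ≡ true
    by-cases (yes refl) (yes refl) = contradiction refl (arc⇒≢ e)
    by-cases (yes refl) (no b≢z₀)  = cong₂ (arc D) φ-z₀ (φ-≢z₀ b≢z₀)
    by-cases (no a≢z₀)  (yes refl) = trans (cong₂ (arc D) (φ-≢z₀ a≢z₀) φ-z₀) (trans (arc-D-to-y a≢z₀) e)
    by-cases (no a≢z₀)  (no b≢z₀)  = trans (cong₂ (arc D) (φ-≢z₀ a≢z₀) (φ-≢z₀ b≢z₀)) (trans (arc-D b≢z₀) e)

  -- Off z₀, splitting adds exactly the arc from y and the arc to x (the arc
  -- to z₀, if any, is redirected to y).
  outdeg-suc : ∀ a → a ≢ z₀ → outdeg D (suc a) ≡ outdeg H a + 1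
  outdeg-suc a a≢z₀ = begin
    outdeg D (suc a)                                ≡⟨ outdeg≡∑ D (suc a) ⟩
    ⟦ arc D (suc a) zero ⟧ + ∑ to-copies           ≡⟨ cong (λ e → ⟦ e ⟧ + ∑ to-copies) (arc-D-to-y a≢z₀) ⟩
    ⟦ arc H a z₀ ⟧ + ∑ to-copies                   ≡⟨ +-comm _ (∑ to-copies) ⟩
    ∑ to-copies + ⟦ arc H a z₀ ⟧                   ≡⟨ ∑-agree-except z₀ (λ b b≢z₀ → cong ⟦_⟧ (arc-D b≢z₀)) ⟩
    ∑ (λ b → ⟦ arc H a b ⟧) + ⟦ arc D (suc a) x ⟧  ≡⟨ cong₂ (λ s e → s + ⟦ e ⟧) (sym (outdeg≡∑ H a)) (arc-D-to-x a≢z₀) ⟩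
    outdeg H a + 1                                  ∎
    where
    open ≡-Reasoning
    to-copies : Fin (suc N) → ℕ
    to-copies b = ⟦ arc D (suc a) (suc b) ⟧

  indeg-suc : ∀ a → a ≢ z₀ → indeg D (suc a) ≡ 1 + indeg H a
  indeg-suc a a≢z₀ = trans (indeg≡∑ D (suc a))
    (cong suc (trans (sum-cong-≗ (λ b → cong ⟦_⟧ (arc-D {b} a≢z₀))) (sym (indeg≡∑ H a))))

  deg-suc : ∀ a → a ≢ z₀ → deg D (suc a) ≡ deg H a + 2
  deg-suc a a≢z₀ = trans (cong₂ _+_ (outdeg-suc a a≢z₀) (indeg-suc a a≢z₀)) (regroup (outdeg H a) (indeg H a))
    where
    regroup : ∀ o i → o + 1 + (1 + i) ≡ o + i + 2
    regroup = solve-∀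

  -- The only non-adjacent pairs of D are copies of non-adjacent pairs of H
  -- avoiding z₀.
  split-degree : DegreeConditionAway H z₀ → DegreeCondition D
  split-degree condition zero    zero    u≢v _          = contradiction refl u≢v
  split-degree condition zero    (suc b) _   (() , _)
  split-degree condition (suc a) zero    _   (_ , ())
  split-degree condition (suc a) (suc b) u≢v (uv∉D , vu∉D) = by-cases (a ≟ z₀) (b ≟ z₀)
    where
    regroup : ∀ p q → p + 2 + (q + 2) ≡ p + q + 4
    regroup = solve-∀
    by-cases : Dec (a ≡ z₀) → Dec (b ≡ z₀) → 2 * suc (suc N) + 1 ≤ deg D (suc a) + deg D (suc b)
    by-cases (yes refl) _          = contradiction (trans (sym vu∉D) (arc-D-to-x (u≢v ∘ cong suc ∘ sym))) λ ()
    by-cases (no a≢z₀)  (yes refl) = contradiction (trans (sym uv∉D) (arc-D-to-x a≢z₀)) λ ()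
    by-cases (no a≢z₀)  (no b≢z₀)  = subst (2 * suc (suc N) + 1 ≤_) (sym degrees)
        (threshold-up (suc N) (deg H a + deg H b)
          (condition a b a≢z₀ b≢z₀ (u≢v ∘ cong suc) (trans (sym (arc-D b≢z₀)) uv∉D , trans (sym (arc-D a≢z₀)) vu∉D)))
      where
      degrees : deg D (suc a) + deg D (suc b) ≡ deg H a + deg H b + 4
      degrees = trans (cong₂ _+_ (deg-suc a a≢z₀) (deg-suc b b≢z₀)) (regroup (deg H a) (deg H b))

  -- D - S is strongly connected when H minus any k - 1 vertices is: if y is
  -- deleted, walks of H survive via suc; if x but not y is deleted, they
  -- survive via φ; if neither is, every vertex reaches x, and y reaches
  -- every vertex.
  module Connectivity (k : ℕ)
    (strong : ∀ (T : Subset (suc N)) → ∣ T ∣ < k → StronglyConnectedMinus H T) where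

    y-deleted : ∀ S → ∣ inside ∷ S ∣ < k + 1 → StronglyConnectedMinus D (inside ∷ S)
    y-deleted S small zero    _       u∉ _  = contradiction u∉ (inside⇒¬∉ refl)
    y-deleted S small (suc a) zero    _  v∉ = contradiction v∉ (inside⇒¬∉ refl)
    y-deleted S small (suc a) (suc b) u∉ v∉ =
      transport suc (λ w∉S → w∉S ∘ drop-there) (λ _ _ _ → suc-arc)
        (unrestricted (strong S small′ a b (drop-not-there u∉) (drop-not-there v∉)))
      where
      small′ : ∣ S ∣ < k
      small′ = ≤-pred (subst (suc ∣ inside ∷ S ∣ ≤_) (+-comm k 1) small)

    x-deleted : ∀ S → lookup S z₀ ≡ inside → ∣ outside ∷ S ∣ < k + 1 → StronglyConnectedMinus D (outside ∷ S)
    x-deleted S x∈S small u v u∉ v∉ =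
      subst₂ (WalkAvoiding D (outside ∷ S)) (φ-ψ u∉) (φ-ψ v∉)
        (transport φ φ∉ (λ _ _ _ → φ-arc) (unrestricted (strong T small′ (ψ u) (ψ v) (ψ∉ u∉) (ψ∉ v∉))))
      where
      T : Subset (suc N)
      T = S [ z₀ ]≔ outside

      small′ : ∣ T ∣ < k
      small′ = subst (_≤ k) (sym (∣remove∣ S z₀ x∈S)) (≤-pred (subst (suc ∣ S ∣ ≤_) (+-comm k 1) small))

      -- ψ inverts φ on the vertices of D other than x.
      ψ : Fin (suc (suc N)) → Fin (suc N)
      ψ zero    = z₀
      ψ (suc a) = a

      ∉⇒≢z₀ : ∀ {a} → suc a ∉ outside ∷ S → a ≢ z₀
      ∉⇒≢z₀ a∉ refl = inside⇒¬∉ x∈S (drop-not-there a∉)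

      φ-ψ : ∀ {w} → w ∉ outside ∷ S → φ (ψ w) ≡ w
      φ-ψ {zero}  _  = φ-z₀
      φ-ψ {suc a} a∉ = φ-≢z₀ (∉⇒≢z₀ a∉)

      ψ∉ : ∀ {w} → w ∉ outside ∷ S → ψ w ∉ T
      ψ∉ {zero}  _  = outside⇒∉ (lookup∘update z₀ S outside)
      ψ∉ {suc a} a∉ = outside⇒∉ (trans (lookup∘update′ (∉⇒≢z₀ a∉) S outside) (∉⇒outside (drop-not-there a∉)))

      φ∉ : ∀ {a} → a ∉ T → φ a ∉ outside ∷ S
      φ∉ {a} a∉T with a ≟ z₀
      ... | yes _    = outside⇒∉ refl
      ... | no a≢z₀  = outside⇒∉ (trans (sym (lookup∘update′ a≢z₀ S outside)) (∉⇒outside a∉T))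

    neither-deleted : ∀ S → lookup S z₀ ≡ outside → StronglyConnectedMinus D (outside ∷ S)
    neither-deleted S x∉S u v u∉ v∉ = to-x u∉ ⊕ step x∉ arc-x-y (from-y v∉)
      where
      x∉ : x ∉ outside ∷ S
      x∉ = outside⇒∉ x∉S
      y∉ : zero ∉ outside ∷ S
      y∉ = outside⇒∉ refl
      to-x : ∀ {w} → w ∉ outside ∷ S → WalkAvoiding D (outside ∷ S) w x
      to-x {zero}  w∉ = step w∉ refl (here x∉)
      to-x {suc a} w∉ with a ≟ z₀
      ... | yes refl = here w∉
      ... | no a≢z₀  = step w∉ (arc-D-to-x a≢z₀) (here x∉)
      from-y : ∀ {w} → w ∉ outside ∷ S → WalkAvoiding D (outside ∷ S) zero w
      from-y {zero}  w∉ = here w∉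
      from-y {suc b} w∉ = step y∉ refl (here w∉)

    connected : ∀ S → ∣ S ∣ < k + 1 → StronglyConnectedMinus D S
    connected (inside  ∷ S) small = y-deleted S small
    connected (outside ∷ S) small with lookup S z₀ in x-status
    ... | inside  = x-deleted S x-status small
    ... | outside = neither-deleted S x-status

  split-strong : ∀ k → KStrong k H → KStrong (k + 1) D
  split-strong k (order , strong) =
    subst (_≤ suc (suc N)) (+-comm 1 (k + 1)) (s≤s order) , Connectivity.connected k strong

  lower-chain : ∀ L → All (z₀ ≢_) L → ArcChain D (map suc L ++ zero ∷ []) → ArcChain H (L ++ z₀ ∷ [])
  lower-chain []          _                   _          = one z₀
  lower-chain (a ∷ [])    (z₀≢a ∷ [])         (cons e _) = cons (trans (sym (arc-D-to-y (z₀≢a ∘ sym))) e) (one z₀)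
  lower-chain (a ∷ b ∷ L) (_ ∷ z₀≢b ∷ z₀≢L) (cons e c) =
    cons (trans (sym (arc-D (z₀≢b ∘ sym))) e) (lower-chain (b ∷ L) (z₀≢b ∷ z₀≢L) c)

  -- (The extra vertex w rules out the degenerate path x → y.)
  hamiltonian-cycle : ∀ (w : Fin (suc N)) → w ≢ z₀ → HamPath D x zero → Hamiltonian H
  hamiltonian-cycle w w≢z₀ (mid , spanning@(_ ∷ unique-rest , _) , path)
    with all-suc mid (last-fresh mid zero unique-rest)
  ... | mid₀ , refl = z₀ , mid₀ , spanning₀ , close mid₀ spanning₀ path
    where
    spanning₀ : Spanning (z₀ ∷ mid₀)
    spanning₀ = spanning-suc⁻ (spanning-↭ (++-comm (x ∷ map suc mid₀) (zero ∷ [])) spanning)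
    close : ∀ L → Spanning (z₀ ∷ L) → ArcChain D (x ∷ map suc L ++ zero ∷ []) → ArcChain H (z₀ ∷ L ++ z₀ ∷ [])
    close []      (_ , covers) _ with covers w
    ... | here w≡z₀ = contradiction w≡z₀ w≢z₀
    close (a ∷ A) ((z₀≢a ∷ z₀≢A) ∷ _ , _) (cons e c) =
      cons (trans (sym (arc-D (z₀≢a ∘ sym))) e) (lower-chain (a ∷ A) (z₀≢a ∷ z₀≢A) c)

HamiltonianCriterion : ℕ → ℕ → Set
HamiltonianCriterion k n =
  ∀ (H : Digraph n) → KStrong k H → Σ (Fin n) (DegreeConditionAway H) → Hamiltonian H

ConnectedCriterion : ℕ → ℕ → Set
ConnectedCriterion k N =
  ∀ (D : Digraph N) → KStrong (k + 1) D → DegreeCondition D → StronglyHamiltonianConnected D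

criterion-lifts : ∀ k n → HamiltonianCriterion k (suc n) → ConnectedCriterion k (suc (suc n))
criterion-lifts k n criterion D strong condition x y x≢y =
  hamiltonian-path (criterion H (merged-strong k strong) (z , merged-degree condition))
  where open Merge D x≢y

-- With two or more vertices, every vertex has a companion; this is what
-- keeps a Hamiltonian cycle of H from being a loop.
another-vertex : ∀ {n} (a : Fin (suc (suc n))) → Σ (Fin (suc (suc n))) (_≢ a)
another-vertex zero    = suc zero , λ ()
another-vertex (suc _) = zero , λ ()

criterion-descends : ∀ k n → ConnectedCriterion k (suc (suc (suc n))) → HamiltonianCriterion k (suc (suc n))
criterion-descends k n criterion H strong (z₀ , condition) =
  hamiltonian-cycle (proj₁ (another-vertex z₀)) (proj₂ (another-vertex z₀))
    (criterion D (split-strong k strong) (split-degree condition) x zero λ ())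
  where open Split H z₀

theorem4p1 : (k n : ℕ) → 1 ≤ k → 8 ≤ n →
    ((∀ (H : Digraph n) → KStrong k H →
        Σ (Fin n) (λ z₀ → ∀ (x y : Fin n) → ¬ (x ≡ z₀) → ¬ (y ≡ z₀) → ¬ (x ≡ y) →
          NonAdjacent H x y → 2 * n ∸ 1 ≤ deg H x + deg H y) →
        Hamiltonian H)
    ⇔
     (∀ (D : Digraph (n + 1)) → KStrong (k + 1) D →
        (∀ (x y : Fin (n + 1)) → ¬ (x ≡ y) →
          NonAdjacent D x y → 2 * (n + 1) + 1 ≤ deg D x + deg D y) →
        StronglyHamiltonianConnected D))
theorem4p1 k zero          _ ()
theorem4p1 k (suc zero)    _ (s≤s ())
theorem4p1 k (suc (suc m)) _ _ = mk⇔
  (λ a⇒ → subst (ConnectedCriterion k) (+-comm 1 (suc (suc m))) (criterion-lifts k (suc m) a⇒))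
  (λ b⇒ → criterion-descends k m (subst (ConnectedCriterion k) (+-comm (suc (suc m)) 1) b⇒))
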